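{- For any integers $k \geq 2$, $n,\alpha,\beta \geq 0$ and $0 \leq m \leq \min(\alpha,\beta)$, $${_m}C^k_{n,(\alpha,\beta)} = C^k_{n,(\alpha-m,\beta-m)} - C^k_{n,(\alpha-m-1,\beta-m-1)}.$$
   Context: For an integer $k\ge 2$ and integers $\alpha,\beta, n\ge 0$, let $\mathcal{D}^k_{n,(\alpha,\beta)}$ be the set of integer lattice paths from $(0,\alpha)$ to $(kn+\beta-\alpha,\beta)$ using steps $U=(1,1)$ and $D=(1,1-k)$ that stay weakly above the line $y=0$ (such paths have exactly $n$ steps $D$; the empty path is included when $n=0$, $\alpha=\beta$), and $C^k_{n,(\alpha,\beta)}=|\mathcal{D}^k_{n,(\alpha,\beta)}|$, with $C^k_{n,(\alpha,\beta)}=0$ if $\alpha<0$ or $\beta<0$. For $m\ge0$, ${_m}C^k_{n,(\alpha,\beta)}$ denotes the number of paths in $\mathcal{D}^k_{n,(\alpha,\beta)}$ whose minimum $y$-coordinate (over all lattice points of the path) equals $m$. -}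

module Defs where

open import Data.Nat using (ℕ; zero; suc; _*_; _∸_; _≡ᵇ_)
import Data.Nat as ℕ
open import Data.Integer as ℤ using (ℤ; +_; -[1+_]; _≤ᵇ_)
open import Data.Bool using (Bool; true; false; _∧_)
open import Data.List using (List; []; _∷_; map; concatMap; filter; length; _++_)
open import Relation.Nullary.Decidable using (Dec; yes; no)
open import Data.Bool.Properties using (_≟_)

-- The two step types: U = (1,1), D = (1,1-k).
data Step : Set where
  U D : Step

words : ℕ → List (List Step)
words zero = [] ∷ []
words (suc L) = concatMap (λ w → (U ∷ w) ∷ (D ∷ w) ∷ []) (words L)

δ : ℕ → Step → ℤ
δ k U = + 1
δ k D = + 1 ℤ.- + k

#D : List Step → ℕ
#D [] = 0
#D (U ∷ w) = #D w
#D (D ∷ w) = suc (#D w)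

endHeight : ℕ → ℤ → List Step → ℤ
endHeight k h [] = h
endHeight k h (s ∷ w) = endHeight k (h ℤ.+ δ k s) w

minHeight : ℕ → ℤ → List Step → ℤ
minHeight k h [] = h
minHeight k h (s ∷ w) = h ℤ.⊓ minHeight k (h ℤ.+ δ k s) w

_==ᶻ_ : ℤ → ℤ → Bool
a ==ᶻ b = (a ≤ᵇ b) ∧ (b ≤ᵇ a)

-- w (starting at height α) is a path in D^k_{n,(α,β)}:
-- exactly n steps D, ends at height β, all lattice points weakly above y = 0.
isPath : ℕ → ℕ → ℕ → ℕ → List Step → Bool
isPath k n α β w =
  (#D w ≡ᵇ n) ∧ (endHeight k (+ α) w ==ᶻ (+ β)) ∧ (+ 0 ≤ᵇ minHeight k (+ α) w)

-- The set D^k_{n,(α,β)} for α, β ≥ 0: paths have kn+β-α steps (x from 0 to kn+β-α).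
-- (If kn+β < α the set is empty; the truncated length 0 then admits no valid path.)
pathsN : ℕ → ℕ → ℕ → ℕ → List (List Step)
pathsN k n α β = filter (λ w → isPath k n α β w ≟ true) (words ((k * n ℕ.+ β) ∸ α))

C : ℕ → ℕ → ℤ → ℤ → ℕ
C k n (+ α) (+ β) = length (pathsN k n α β)
C k n (+ α) -[1+ _ ] = 0
C k n -[1+ _ ] _ = 0

mC : ℕ → ℕ → ℕ → ℕ → ℕ → ℕ
mC m k n α β =
  length (filter (λ w → (minHeight k (+ α) w ==ᶻ (+ m)) ≟ true) (pathsN k n α β))

-- Translating a path vertically by j changes neither its step word nor its number of D steps,
-- so C^k_{n,(a,b)} also counts the words of the same length that go from height a + j to
-- b + j while staying weakly above height j.  With α = a + m and β = b + m, the paths of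
-- D^k_{n,(α,β)} with minimum exactly m are those staying above m but not above m + 1, which
-- gives C^k_{n,(a,b)} − C^k_{n,(a−1,b−1)}.  When a = 0 or b = 0 no path stays above m + 1,
-- since the minimum never exceeds the start or end height; this matches C = 0 for a
-- negative argument.
module Submission where

open import Defs
open import Data.Nat using (ℕ; _≤_)
open import Data.Integer using (ℤ; +_; _-_)
open import Relation.Binary.PropositionalEquality using (_≡_)

open import Algebra.Bundles using (AbelianGroup)
open import Data.Bool using (Bool; true; false; _∧_; T)
open import Data.Bool.Properties using (_≟_; ∧-assoc; T-≡; T-∧)
open import Data.Integer as ℤ using (-[1+_]; _≤ᵇ_; _⊓_)
import Data.Integer.Properties as ℤ
open import Data.List using (List; []; _∷_; filter; length)
open import Data.List.Properties using (filter-≐; filter-none)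
import Data.List.Relation.Unary.All as All
open import Data.Nat as ℕ using (zero; suc; _+_; _*_; _∸_; _<ᵇ_; _≡ᵇ_)
import Data.Nat.Properties as ℕ
open import Data.Product using (_×_; _,_; proj₁; proj₂)
open import Function using (_∘_; mk⇔; Equivalence)
open import Relation.Nullary using (¬_; T?)
open import Relation.Nullary.Decidable using (does-⇔)
open import Relation.Binary.PropositionalEquality
  using (refl; sym; trans; cong; cong₂; subst; subst₂; module ≡-Reasoning)
open import Algebra.Properties.CommutativeSemigroup ℕ.+-commutativeSemigroup
  using (interchange)
open import Algebra.Properties.CommutativeSemigroup ℤ.+-commutativeSemigroup
  using (xy∙z≈xz∙y)
open import Algebra.Properties.Group (AbelianGroup.group ℤ.+-0-abelianGroup)
  using (//-rightDividesʳ)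

open ≡-Reasoning

indicator : Bool → ℕ
indicator true = 1
indicator false = 0

module _ {A : Set} where

  -- Filtering through _≟_ exactly as Defs does makes C and mC unfold to counts.
  count : (A → Bool) → List A → ℕ
  count p = length ∘ filter (λ x → p x ≟ true)

  count-∷ : ∀ (p : A → Bool) x xs → count p (x ∷ xs) ≡ indicator (p x) + count p xs
  count-∷ p x xs with p x
  ... | true = refl
  ... | false = refl

  count-cong : ∀ {p q} → (∀ x → p x ≡ q x) → ∀ xs → count p xs ≡ count q xs
  count-cong p≗q =
    cong length ∘ filter-≐ _ _ ((λ {x} → trans (sym (p≗q x))) , (λ {x} → trans (p≗q x)))

  count-filter : ∀ (p q : A → Bool) xs →
    count q (filter (λ x → p x ≟ true) xs) ≡ count (λ x → p x ∧ q x) xs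
  count-filter p q [] = refl
  count-filter p q (x ∷ xs) with p x
  ... | false = count-filter p q xs
  ... | true with q x
  ...   | false = count-filter p q xs
  ...   | true = cong suc (count-filter p q xs)

  count-+ : ∀ {p q r} → (∀ x → indicator (p x) + indicator (q x) ≡ indicator (r x)) →
    ∀ xs → count p xs + count q xs ≡ count r xs
  count-+ split [] = refl
  count-+ {p} {q} {r} split (x ∷ xs) = begin
    count p (x ∷ xs) + count q (x ∷ xs)
      ≡⟨ cong₂ _+_ (count-∷ p x xs) (count-∷ q x xs) ⟩
    (indicator (p x) + count p xs) + (indicator (q x) + count q xs)
      ≡⟨ interchange (indicator (p x)) _ _ _ ⟩
    (indicator (p x) + indicator (q x)) + (count p xs + count q xs)
      ≡⟨ cong₂ _+_ (split x) (count-+ split xs) ⟩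
    indicator (r x) + count r xs
      ≡⟨ count-∷ r x xs ⟨
    count r (x ∷ xs) ∎

  count-none : ∀ {p} → (∀ x → ¬ T (p x)) → ∀ xs → count p xs ≡ 0
  count-none none xs =
    cong length (filter-none _ (All.universal (λ x → none x ∘ Equivalence.from T-≡) xs))

≤ᵇ-+-cancelʳ : ∀ i j c → (i ℤ.+ c ≤ᵇ j ℤ.+ c) ≡ (i ≤ᵇ j)
≤ᵇ-+-cancelʳ i j c = does-⇔ (mk⇔ (T-map cancel) (T-map (ℤ.+-monoˡ-≤ c {i} {j}))) (T? _) (T? _)
  where
  T-map : ∀ {i′ j′ i″ j″} → (i′ ℤ.≤ j′ → i″ ℤ.≤ j″) → T (i′ ≤ᵇ j′) → T (i″ ≤ᵇ j″)
  T-map f = ℤ.≤⇒≤ᵇ ∘ f ∘ ℤ.≤ᵇ⇒≤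
  cancel : i ℤ.+ c ℤ.≤ j ℤ.+ c → i ℤ.≤ j
  cancel = subst₂ ℤ._≤_ (//-rightDividesʳ c i) (//-rightDividesʳ c j) ∘ ℤ.+-monoˡ-≤ (ℤ.- c)

==ᶻ-+-cancelʳ : ∀ i j c → ((i ℤ.+ c) ==ᶻ (j ℤ.+ c)) ≡ (i ==ᶻ j)
==ᶻ-+-cancelʳ i j c = cong₂ _∧_ (≤ᵇ-+-cancelʳ i j c) (≤ᵇ-+-cancelʳ j i c)

==ᶻ⇒≡ : ∀ {i j} → T (i ==ᶻ j) → i ≡ j
==ᶻ⇒≡ i==j with Equivalence.to T-∧ i==j
... | i≤j , j≤i = ℤ.≤-antisym (ℤ.≤ᵇ⇒≤ i≤j) (ℤ.≤ᵇ⇒≤ j≤i)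

endHeight-+ : ∀ k h c w → endHeight k (h ℤ.+ c) w ≡ endHeight k h w ℤ.+ c
endHeight-+ k h c [] = refl
endHeight-+ k h c (s ∷ w) = begin
  endHeight k (h ℤ.+ c ℤ.+ δ k s) w  ≡⟨ cong (λ h′ → endHeight k h′ w) (xy∙z≈xz∙y h c (δ k s)) ⟩
  endHeight k (h ℤ.+ δ k s ℤ.+ c) w  ≡⟨ endHeight-+ k (h ℤ.+ δ k s) c w ⟩
  endHeight k (h ℤ.+ δ k s) w ℤ.+ c  ∎

minHeight-+ : ∀ k h c w → minHeight k (h ℤ.+ c) w ≡ minHeight k h w ℤ.+ c
minHeight-+ k h c [] = refl
minHeight-+ k h c (s ∷ w) = begin
  (h ℤ.+ c) ⊓ minHeight k (h ℤ.+ c ℤ.+ δ k s) w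
    ≡⟨ cong (λ h′ → (h ℤ.+ c) ⊓ minHeight k h′ w) (xy∙z≈xz∙y h c (δ k s)) ⟩
  (h ℤ.+ c) ⊓ minHeight k (h ℤ.+ δ k s ℤ.+ c) w
    ≡⟨ cong ((h ℤ.+ c) ⊓_) (minHeight-+ k (h ℤ.+ δ k s) c w) ⟩
  (h ℤ.+ c) ⊓ (minHeight k (h ℤ.+ δ k s) w ℤ.+ c)
    ≡⟨ ℤ.mono-≤-distrib-⊓ (ℤ.+-monoˡ-≤ c) h _ ⟨
  h ⊓ minHeight k (h ℤ.+ δ k s) w ℤ.+ c ∎

minHeight≤start : ∀ k h w → minHeight k h w ℤ.≤ h
minHeight≤start k h [] = ℤ.≤-refl
minHeight≤start k h (s ∷ w) = ℤ.i⊓j≤i h _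

minHeight≤endHeight : ∀ k h w → minHeight k h w ℤ.≤ endHeight k h w
minHeight≤endHeight k h [] = ℤ.≤-refl
minHeight≤endHeight k h (s ∷ w) =
  ℤ.≤-trans (ℤ.i⊓j≤j h _) (minHeight≤endHeight k (h ℤ.+ δ k s) w)

isPathAbove : ℕ → ℕ → ℕ → ℕ → ℕ → List Step → Bool
isPathAbove k n α β j w =
  (#D w ≡ᵇ n) ∧ (endHeight k (+ α) w ==ᶻ (+ β)) ∧ (+ j ≤ᵇ minHeight k (+ α) w)

isPath-lift : ∀ k n a b j w → isPath k n a b w ≡ isPathAbove k n (a + j) (b + j) j w
isPath-lift k n a b j w
  rewrite ℤ.pos-+ a j | ℤ.pos-+ b j
        | endHeight-+ k (+ a) (+ j) w | minHeight-+ k (+ a) (+ j) w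
        | ==ᶻ-+-cancelʳ (endHeight k (+ a) w) (+ b) (+ j)
        | ≤ᵇ-+-cancelʳ (+ 0) (minHeight k (+ a) w) (+ j) = refl

[m+o]∸[n+o]≡m∸n : ∀ m n o → (m + o) ∸ (n + o) ≡ m ∸ n
[m+o]∸[n+o]≡m∸n m n o =
  trans (cong₂ _∸_ (ℕ.+-comm m o) (ℕ.+-comm n o)) (ℕ.[m+n]∸[m+o]≡n∸o o m n)

C-lift : ∀ {k n a b j α β} → a + j ≡ α → b + j ≡ β →
  C k n (+ a) (+ b) ≡ count (isPathAbove k n α β j) (words ((k * n + β) ∸ α))
C-lift {k} {n} {a} {b} {j} refl refl = begin
  count (isPath k n a b) (words ((k * n + b) ∸ a))
    ≡⟨ count-cong (isPath-lift k n a b j) (words ((k * n + b) ∸ a)) ⟩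
  count (isPathAbove k n (a + j) (b + j) j) (words ((k * n + b) ∸ a))
    ≡⟨ cong (count (isPathAbove k n (a + j) (b + j) j) ∘ words) length-lift ⟨
  count (isPathAbove k n (a + j) (b + j) j) (words ((k * n + (b + j)) ∸ (a + j))) ∎
  where
  length-lift : (k * n + (b + j)) ∸ (a + j) ≡ (k * n + b) ∸ a
  length-lift = trans (cong (_∸ (a + j)) (sym (ℕ.+-assoc (k * n) b j)))
                      ([m+o]∸[n+o]≡m∸n (k * n + b) a j)

isPathAbove⇒≤ : ∀ {k n α β j} w → T (isPathAbove k n α β j w) → j ≤ α × j ≤ β
isPathAbove⇒≤ {k} {n} {α} {β} {j} w path =
  ℤ.drop‿+≤+ (ℤ.≤-trans j≤min (minHeight≤start k (+ α) w)) ,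
  ℤ.drop‿+≤+ (ℤ.≤-trans j≤min min≤β)
  where
  ends-above : T (endHeight k (+ α) w ==ᶻ (+ β)) × T (+ j ≤ᵇ minHeight k (+ α) w)
  ends-above = Equivalence.to T-∧ (proj₂ (Equivalence.to (T-∧ {#D w ≡ᵇ n}) path))
  j≤min : + j ℤ.≤ minHeight k (+ α) w
  j≤min = ℤ.≤ᵇ⇒≤ (proj₂ ends-above)
  min≤β : minHeight k (+ α) w ℤ.≤ + β
  min≤β = subst (minHeight k (+ α) w ℤ.≤_) (==ᶻ⇒≡ (proj₁ ends-above))
                (minHeight≤endHeight k (+ α) w)

<ᵇ-suc : ∀ x m → (x <ᵇ suc m) ≡ (x ℕ.≤ᵇ m)
<ᵇ-suc zero m = refl
<ᵇ-suc (suc x) m = refl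

indicator-≤ᵇ-split : ∀ x m →
  indicator ((x ℕ.≤ᵇ m) ∧ (m ℕ.≤ᵇ x)) + indicator (suc m ℕ.≤ᵇ x) ≡ indicator (m ℕ.≤ᵇ x)
indicator-≤ᵇ-split zero zero = refl
indicator-≤ᵇ-split zero (suc m) = refl
indicator-≤ᵇ-split (suc x) zero = refl
indicator-≤ᵇ-split (suc x) (suc m) rewrite <ᵇ-suc x m | <ᵇ-suc m x = indicator-≤ᵇ-split x m

indicator-≤ᵇ-splitᶻ : ∀ h m →
  indicator ((+ 0 ≤ᵇ h) ∧ (h ==ᶻ (+ m))) + indicator (+ suc m ≤ᵇ h) ≡ indicator (+ m ≤ᵇ h)
indicator-≤ᵇ-splitᶻ (+ x) m = indicator-≤ᵇ-split x m
indicator-≤ᵇ-splitᶻ -[1+ x ] m = refl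

indicator-∧-split : ∀ a {x y z} → indicator x + indicator y ≡ indicator z →
  indicator (a ∧ x) + indicator (a ∧ y) ≡ indicator (a ∧ z)
indicator-∧-split true split = split
indicator-∧-split false split = refl

indicator-minHeight-split : ∀ k n α β m w →
  indicator (isPath k n α β w ∧ (minHeight k (+ α) w ==ᶻ (+ m)))
    + indicator (isPathAbove k n α β (suc m) w)
  ≡ indicator (isPathAbove k n α β m w)
indicator-minHeight-split k n α β m w = begin
  indicator ((D? ∧ ends ∧ (+ 0 ≤ᵇ M)) ∧ (M ==ᶻ (+ m))) + above
    ≡⟨ cong (λ b → indicator b + above)
            (trans (∧-assoc D? _ _) (cong (D? ∧_) (∧-assoc ends _ _))) ⟩
  indicator (D? ∧ ends ∧ (+ 0 ≤ᵇ M) ∧ (M ==ᶻ (+ m))) + above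
    ≡⟨ indicator-∧-split D? (indicator-∧-split ends (indicator-≤ᵇ-splitᶻ M m)) ⟩
  indicator (isPathAbove k n α β m w) ∎
  where
  D? = #D w ≡ᵇ n
  ends = endHeight k (+ α) w ==ᶻ (+ β)
  M = minHeight k (+ α) w
  above = indicator (isPathAbove k n α β (suc m) w)

C-lift-pred : ∀ {k n a b m α β} → a + m ≡ α → b + m ≡ β →
  C k n (+ a - + 1) (+ b - + 1) ≡ count (isPathAbove k n α β (suc m)) (words ((k * n + β) ∸ α))
C-lift-pred {a = suc a} {suc b} {m} a+m≡α b+m≡β =
  C-lift (trans (ℕ.+-suc a m) a+m≡α) (trans (ℕ.+-suc b m) b+m≡β)
C-lift-pred {k} {n} {zero} {m = m} {β = β} refl _ =
  sym (count-none (λ w → ℕ.n≮n m ∘ proj₁ ∘ isPathAbove⇒≤ {k} {n} {m} {β} w)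
                  (words ((k * n + β) ∸ m)))
C-lift-pred {k} {n} {suc a} {zero} {m} {α} a+m≡α refl =
  sym (count-none (λ w → ℕ.n≮n m ∘ proj₂ ∘ isPathAbove⇒≤ {k} {n} {α} {m} w)
                  (words ((k * n + m) ∸ α)))

mC+C[a-1,b-1]≡C[a,b] : ∀ {k n a b m α β} → a + m ≡ α → b + m ≡ β →
  mC m k n α β + C k n (+ a - + 1) (+ b - + 1) ≡ C k n (+ a) (+ b)
mC+C[a-1,b-1]≡C[a,b] {k} {n} {a} {b} {m} {α} {β} a+m≡α b+m≡β = begin
  mC m k n α β + C k n (+ a - + 1) (+ b - + 1)
    ≡⟨ cong₂ _+_ (count-filter (isPath k n α β) minimum-is-m ws) (C-lift-pred a+m≡α b+m≡β) ⟩
  count (λ w → isPath k n α β w ∧ minimum-is-m w) ws + count (isPathAbove k n α β (suc m)) ws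
    ≡⟨ count-+ (indicator-minHeight-split k n α β m) ws ⟩
  count (isPathAbove k n α β m) ws
    ≡⟨ C-lift a+m≡α b+m≡β ⟨
  C k n (+ a) (+ b) ∎
  where
  ws = words ((k * n + β) ∸ α)
  minimum-is-m = λ w → minHeight k (+ α) w ==ᶻ (+ m)

+m-+n≡+[m∸n] : ∀ {m n} → n ≤ m → + m - + n ≡ + (m ∸ n)
+m-+n≡+[m∸n] {m} {n} n≤m = trans (ℤ.m-n≡m⊖n m n) (ℤ.⊖-≥ n≤m)

m+n≡o⇒+m≡+o-+n : ∀ {m n o} → m + n ≡ o → + m ≡ + o - + n
m+n≡o⇒+m≡+o-+n {m} {n} refl =
  sym (trans (+m-+n≡+[m∸n] (ℕ.m≤n+m n m)) (cong +_ (ℕ.m+n∸n≡m m n)))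

proposition3p1 : (k n α β m : ℕ) → 2 ≤ k → m ≤ α → m ≤ β →
    + mC m k n α β ≡
      + C k n (+ α - + m) (+ β - + m) - + C k n (+ α - + m - + 1) (+ β - + m - + 1)
proposition3p1 k n α β m _ m≤α m≤β = begin
  + mC m k n α β
    ≡⟨ m+n≡o⇒+m≡+o-+n (mC+C[a-1,b-1]≡C[a,b] (ℕ.m∸n+n≡m m≤α) (ℕ.m∸n+n≡m m≤β)) ⟩
  C-difference (+ (α ∸ m)) (+ (β ∸ m))
    ≡⟨ cong₂ C-difference (+m-+n≡+[m∸n] m≤α) (+m-+n≡+[m∸n] m≤β) ⟨
  C-difference (+ α - + m) (+ β - + m) ∎
  where
  C-difference : ℤ → ℤ → ℤ
  C-difference a b = + C k n a b - + C k n (a - + 1) (b - + 1)
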